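{- Let $\sigma\in\mathfrak{S}_k$ and $\tau\in\mathfrak{S}_\ell$ ($k,\ell\ge1$). There is exactly one permutation $\gamma$ in the set $\sigma\#\tau$ such that the set of values $\{\gamma_1,\gamma_2,\dots,\gamma_k\}$ is an interval of integers.
   Context: For a word $w$, $\mathrm{std}(w)$ denotes its standardization (the permutation obtained by numbering $1,2,\dots$ from left to right the occurrences of the smallest letter, then those of the next smallest letter, and so on). For $\sigma\in\mathfrak{S}_k$ and $\tau\in\mathfrak{S}_\ell$, $\sigma\#\tau$ denotes the set of permutations $\nu\in\mathfrak{S}_{k+\ell-1}$ such that $\mathrm{std}(\nu_1\cdots\nu_k)=\sigma$ and $\mathrm{std}(\nu_k\cdots\nu_{k+\ell-1})=\tau$. -}

module Defs where

open import Data.Nat using (ℕ; suc; _+_; _≤_; _<_; _<?_; _≟_)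
open import Data.Nat.Properties using (+-suc)
open import Data.Fin using (Fin; toℕ; _↑ˡ_; _↑ʳ_; cast) renaming (_<?_ to _<ᶠ?_)
open import Data.Fin.Permutation using (Permutation′; _⟨$⟩ʳ_)
open import Data.List using (List; length; filter; allFin)
open import Data.Product using (Σ; ∃; _×_; _,_)
open import Relation.Nullary using (Dec; yes; no)
open import Relation.Nullary.Decidable using (_×-dec_)
open import Relation.Binary.PropositionalEquality using (_≡_; sym)

Word : ℕ → Set
Word m = Fin m → ℕ

-- Standardization (0-based: values in {0,…,m-1}).
-- std(w)_i = #{ j | w_j < w_i } + #{ j | j < i and w_j = w_i }
std : ∀ {m} → Word m → Fin m → ℕ
std {m} w i =
  length (filter (λ j → w j <? w i) (allFin m))
  + length (filter (λ j → (j <ᶠ? i) ×-dec (w j ≟ w i)) (allFin m))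

StdEq : ∀ {m} → Word m → Permutation′ m → Set
StdEq {m} w σ = ∀ i → std w i ≡ toℕ (σ ⟨$⟩ʳ i)

word : ∀ {n} → Permutation′ n → Word n
word ν i = toℕ (ν ⟨$⟩ʳ i)

-- For k = suc a, ℓ = suc b: positions 1..k and k..k+ℓ-1 of a word of
-- length k+ℓ-1 = a + suc b (written 0-based).
prefixPos : ∀ a b → Fin (suc a) → Fin (a + suc b)
prefixPos a b i = cast (sym (+-suc a b)) (i ↑ˡ b)

suffixPos : ∀ a b → Fin (suc b) → Fin (a + suc b)
suffixPos a b j = a ↑ʳ j

InSharp : ∀ a b → Permutation′ (suc a) → Permutation′ (suc b)
        → Permutation′ (a + suc b) → Set
InSharp a b σ τ ν =
  StdEq (λ i → word ν (prefixPos a b i)) σ ×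
  StdEq (λ j → word ν (suffixPos a b j)) τ

IsInterval : (ℕ → Set) → Set
IsInterval S = ∀ x y z → S x → S z → x ≤ y → y ≤ z → S y

prefixValues : ∀ a b → Permutation′ (a + suc b) → ℕ → Set
prefixValues a b γ v = ∃ λ (i : Fin (suc a)) → word γ (prefixPos a b i) ≡ v

Good : ∀ a b → Permutation′ (suc a) → Permutation′ (suc b)
     → Permutation′ (a + suc b) → Set
Good a b σ τ γ = InSharp a b σ τ γ × IsInterval (prefixValues a b γ)

-- With 0-based values, write k = a + 1 and ℓ = b + 1. If the first k values of γ ∈ σ # τ
-- form an interval starting at c, standardization forces them to be c + σ(i). The letter at
-- position a is shared with the suffix, and every other suffix letter avoids [c, c + a]. Since
-- γ is a permutation, exactly c of its values lie below c; these are precisely the suffix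
-- letters below the shared one, and there are τ(0) of them, so c = τ(0). Counting in the same
-- way, a later suffix letter of rank r in τ has value r if r < τ(0) and a + r otherwise. So γ
-- is unique, and conversely these formulas define an injective word with the required
-- standardizations.

module Submission where

open import Defs
open import Data.Nat using (ℕ; zero; suc; _+_; _∸_; _≤_; _<_; _<?_; _≟_; z≤n; s≤s; s≤s⁻¹)
open import Data.Nat.Properties
open import Data.Fin as Fin using (Fin; toℕ; _↑ˡ_; _↑ʳ_; inject₁; fromℕ; fromℕ<; splitAt; punchOut)
import Data.Fin.Properties as Finₚ
open import Data.Fin.Permutation using (Permutation′; _⟨$⟩ʳ_; _⟨$⟩ˡ_; inverseˡ; inverseʳ; permutation)
open import Data.List using (length; filter; tabulate)
open import Data.Product using (Σ; ∃; _×_; _,_; proj₁; proj₂)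
open import Data.Sum using (_⊎_; inj₁; inj₂; [_,_]′)
open import Data.Empty using (⊥-elim)
open import Function using (_∘_; id)
open import Function.Definitions using (Injective)
open import Relation.Binary.Core using (_Preserves_⟶_)
open import Relation.Binary.Definitions using (tri<; tri≈; tri>)
open import Relation.Nullary using (Dec; yes; no; ¬_; _×-dec_)
open import Relation.Binary.PropositionalEquality

indicator : ∀ {P : Set} → Dec P → ℕ
indicator (yes _) = 1
indicator (no _)  = 0

count : ∀ {m} {P : Fin m → Set} → (∀ i → Dec (P i)) → ℕ
count {zero}  P? = 0
count {suc m} P? = indicator (P? Fin.zero) + count (P? ∘ Fin.suc)

length-filter-tabulate : ∀ {A : Set} {m} {P : A → Set} (P? : ∀ x → Dec (P x)) (f : Fin m → A) →
                         length (filter P? (tabulate f)) ≡ count (P? ∘ f)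
length-filter-tabulate {m = zero}  P? f = refl
length-filter-tabulate {m = suc m} P? f with P? (f Fin.zero)
... | yes _ = cong suc (length-filter-tabulate P? (f ∘ Fin.suc))
... | no _  = length-filter-tabulate P? (f ∘ Fin.suc)

count-cong : ∀ {m} {P Q : Fin m → Set} (P? : ∀ i → Dec (P i)) (Q? : ∀ i → Dec (Q i)) →
             (∀ i → P i → Q i) → (∀ i → Q i → P i) → count P? ≡ count Q?
count-cong {zero}  P? Q? P⇒Q Q⇒P = refl
count-cong {suc m} P? Q? P⇒Q Q⇒P with P? Fin.zero | Q? Fin.zero
... | yes _ | yes _ = cong suc (count-cong (P? ∘ Fin.suc) (Q? ∘ Fin.suc) (P⇒Q ∘ Fin.suc) (Q⇒P ∘ Fin.suc))
... | no _  | no _  = count-cong (P? ∘ Fin.suc) (Q? ∘ Fin.suc) (P⇒Q ∘ Fin.suc) (Q⇒P ∘ Fin.suc)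
... | yes p | no ¬q = ⊥-elim (¬q (P⇒Q Fin.zero p))
... | no ¬p | yes q = ⊥-elim (¬p (Q⇒P Fin.zero q))

count-none : ∀ {m} {P : Fin m → Set} (P? : ∀ i → Dec (P i)) → (∀ i → ¬ P i) → count P? ≡ 0
count-none {zero}  P? ¬P = refl
count-none {suc m} P? ¬P with P? Fin.zero
... | yes p = ⊥-elim (¬P Fin.zero p)
... | no _  = count-none (P? ∘ Fin.suc) (¬P ∘ Fin.suc)

count-all : ∀ {m} {P : Fin m → Set} (P? : ∀ i → Dec (P i)) → (∀ i → P i) → count P? ≡ m
count-all {zero}  P? P = refl
count-all {suc m} P? P with P? Fin.zero
... | yes _ = cong suc (count-all (P? ∘ Fin.suc) (P ∘ Fin.suc))
... | no ¬p = ⊥-elim (¬p (P Fin.zero))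

count-witness : ∀ {m} {P : Fin m → Set} (P? : ∀ i → Dec (P i)) {i} → P i → 0 < count P?
count-witness {suc m} P? {i} p with P? Fin.zero | i
... | yes _ | _ = s≤s z≤n
... | no ¬p | Fin.zero  = ⊥-elim (¬p p)
... | no _  | Fin.suc i = count-witness (P? ∘ Fin.suc) p

count-mono : ∀ {m} {P Q : Fin m → Set} (P? : ∀ i → Dec (P i)) (Q? : ∀ i → Dec (Q i)) →
             (∀ i → P i → Q i) → count P? ≤ count Q?
count-mono {zero}  P? Q? P⇒Q = z≤n
count-mono {suc m} P? Q? P⇒Q with P? Fin.zero | Q? Fin.zero
... | yes p | no ¬q = ⊥-elim (¬q (P⇒Q Fin.zero p))
... | yes _ | yes _ = s≤s (count-mono (P? ∘ Fin.suc) (Q? ∘ Fin.suc) (P⇒Q ∘ Fin.suc))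
... | no _  | yes _ = m≤n⇒m≤1+n (count-mono (P? ∘ Fin.suc) (Q? ∘ Fin.suc) (P⇒Q ∘ Fin.suc))
... | no _  | no _  = count-mono (P? ∘ Fin.suc) (Q? ∘ Fin.suc) (P⇒Q ∘ Fin.suc)

count-< : ∀ {m} {P Q : Fin m → Set} (P? : ∀ i → Dec (P i)) (Q? : ∀ i → Dec (Q i)) →
          (∀ i → P i → Q i) → ∀ {i} → Q i → ¬ P i → count P? < count Q?
count-< {suc m} P? Q? P⇒Q {Fin.zero} q ¬p with P? Fin.zero | Q? Fin.zero
... | yes p | _     = ⊥-elim (¬p p)
... | no _  | no ¬q = ⊥-elim (¬q q)
... | no _  | yes _ = s≤s (count-mono (P? ∘ Fin.suc) (Q? ∘ Fin.suc) (P⇒Q ∘ Fin.suc))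
count-< {suc m} P? Q? P⇒Q {Fin.suc i} q ¬p with P? Fin.zero | Q? Fin.zero
... | yes p | no ¬q = ⊥-elim (¬q (P⇒Q Fin.zero p))
... | yes _ | yes _ = s≤s (count-< (P? ∘ Fin.suc) (Q? ∘ Fin.suc) (P⇒Q ∘ Fin.suc) q ¬p)
... | no _  | yes _ = m<n⇒m<1+n (count-< (P? ∘ Fin.suc) (Q? ∘ Fin.suc) (P⇒Q ∘ Fin.suc) q ¬p)
... | no _  | no _  = count-< (P? ∘ Fin.suc) (Q? ∘ Fin.suc) (P⇒Q ∘ Fin.suc) q ¬p

count-≡ : ∀ {m} (i : Fin m) → count (Finₚ._≟ i) ≡ 1
count-≡ {suc m} Fin.zero    = cong suc (count-none {m} (λ j → Fin.suc j Finₚ.≟ Fin.zero) (λ _ ()))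
count-≡ {suc m} (Fin.suc i) = trans
  (count-cong (λ j → Fin.suc j Finₚ.≟ Fin.suc i) (Finₚ._≟ i)
              (λ _ → Finₚ.suc-injective) (λ _ → cong Fin.suc))
  (count-≡ i)

count-⊎ : ∀ {m} {R P Q : Fin m → Set}
          (R? : ∀ i → Dec (R i)) (P? : ∀ i → Dec (P i)) (Q? : ∀ i → Dec (Q i)) →
          (∀ i → R i → P i ⊎ Q i) → (∀ i → P i ⊎ Q i → R i) → (∀ i → P i → ¬ Q i) →
          count R? ≡ count P? + count Q?
count-⊎ {zero} R? P? Q? R⇒P⊎Q P⊎Q⇒R disjoint = refl
count-⊎ {suc m} R? P? Q? R⇒P⊎Q P⊎Q⇒R disjoint
  with count-⊎ (R? ∘ Fin.suc) (P? ∘ Fin.suc) (Q? ∘ Fin.suc)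
               (R⇒P⊎Q ∘ Fin.suc) (P⊎Q⇒R ∘ Fin.suc) (disjoint ∘ Fin.suc)
     | R? Fin.zero | P? Fin.zero | Q? Fin.zero
... | _    | _     | yes p | yes q = ⊥-elim (disjoint Fin.zero p q)
... | rest | yes _ | yes _ | no _  = cong suc rest
... | rest | yes _ | no _  | yes _ = trans (cong suc rest) (sym (+-suc _ _))
... | _    | yes r | no ¬p | no ¬q = ⊥-elim ([ ¬p , ¬q ]′ (R⇒P⊎Q Fin.zero r))
... | _    | no ¬r | yes p | _     = ⊥-elim (¬r (P⊎Q⇒R Fin.zero (inj₁ p)))
... | _    | no ¬r | _     | yes q = ⊥-elim (¬r (P⊎Q⇒R Fin.zero (inj₂ q)))
... | rest | no _  | no _  | no _  = rest

count-↑ : ∀ m {n} {P : Fin (m + n) → Set} (P? : ∀ i → Dec (P i)) →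
          count P? ≡ count (λ i → P? (i ↑ˡ n)) + count (λ j → P? (m ↑ʳ j))
count-↑ zero    P? = refl
count-↑ (suc m) P? = trans (cong (indicator (P? Fin.zero) +_) (count-↑ m (P? ∘ Fin.suc)))
                           (sym (+-assoc (indicator (P? Fin.zero)) _ _))

count<-+ : ∀ {m} (u : Word m) → Injective _≡_ _≡_ u → ∀ c d →
           (∀ {x} → c ≤ x → x < c + d → ∃ λ i → u i ≡ x) →
           count (λ j → u j <? c + d) ≡ count (λ j → u j <? c) + d
count<-+ u u-injective c zero covered =
  trans (cong (λ v → count (λ j → u j <? v)) (+-identityʳ c)) (sym (+-identityʳ _))
count<-+ u u-injective c (suc d) covered = begin
  count (λ j → u j <? c + suc d)
    ≡⟨ count-⊎ _ _ (Finₚ._≟ i₀) below-or-i₀ below-or-i₀⇒ i₀-not-below ⟩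
  count (λ j → u j <? c + d) + count (Finₚ._≟ i₀)
    ≡⟨ cong₂ _+_ (count<-+ u u-injective c d covered′) (count-≡ i₀) ⟩
  count (λ j → u j <? c) + d + 1
    ≡⟨ +-assoc _ d 1 ⟩
  count (λ j → u j <? c) + (d + 1)
    ≡⟨ cong (count (λ j → u j <? c) +_) (+-comm d 1) ⟩
  count (λ j → u j <? c) + suc d
    ∎
  where
  open ≡-Reasoning
  c+d<c+1+d : c + d < c + suc d
  c+d<c+1+d = +-monoʳ-< c (n<1+n d)
  covered′ : ∀ {x} → c ≤ x → x < c + d → ∃ λ i → u i ≡ x
  covered′ c≤x x<c+d = covered c≤x (<-trans x<c+d c+d<c+1+d)
  i₀ : Fin _
  i₀ = proj₁ (covered (m≤m+n c d) c+d<c+1+d)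
  ui₀≡c+d : u i₀ ≡ c + d
  ui₀≡c+d = proj₂ (covered (m≤m+n c d) c+d<c+1+d)
  below-or-i₀ : ∀ j → u j < c + suc d → u j < c + d ⊎ j ≡ i₀
  below-or-i₀ j lt with m<1+n⇒m<n∨m≡n (subst (u j <_) (+-suc c d) lt)
  ... | inj₁ lt′ = inj₁ lt′
  ... | inj₂ eq  = inj₂ (u-injective (trans eq (sym ui₀≡c+d)))
  below-or-i₀⇒ : ∀ j → u j < c + d ⊎ j ≡ i₀ → u j < c + suc d
  below-or-i₀⇒ j (inj₁ lt)   = <-trans lt c+d<c+1+d
  below-or-i₀⇒ j (inj₂ refl) = subst (_< c + suc d) (sym ui₀≡c+d) c+d<c+1+d
  i₀-not-below : ∀ j → u j < c + d → ¬ j ≡ i₀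
  i₀-not-below j lt refl = <-irrefl ui₀≡c+d lt

std-injective : ∀ {m} (u : Word m) → Injective _≡_ _≡_ u →
                ∀ i → std u i ≡ count (λ j → u j <? u i)
std-injective u u-injective i = begin
  std u i
    ≡⟨ cong₂ _+_ (length-filter-tabulate (λ j → u j <? u i) id) (length-filter-tabulate earlierTies id) ⟩
  count (λ j → u j <? u i) + count earlierTies
    ≡⟨ cong (count (λ j → u j <? u i) +_) (count-none earlierTies noTies) ⟩
  count (λ j → u j <? u i) + 0
    ≡⟨ +-identityʳ _ ⟩
  count (λ j → u j <? u i)
    ∎
  where
  open ≡-Reasoning
  earlierTies : ∀ j → Dec (j Fin.< i × u j ≡ u i)
  earlierTies j = (j Fin.<? i) ×-dec (u j ≟ u i)
  noTies : ∀ j → ¬ (j Fin.< i × u j ≡ u i)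
  noTies j (j<i , uj≡ui) = Finₚ.<-irrefl (u-injective uj≡ui) j<i

std-injective-< : ∀ {m} (u : Word m) (π : Permutation′ m) → Injective _≡_ _≡_ u → StdEq u π →
                  ∀ {i j} → u i < u j → word π i < word π j
std-injective-< u π u-injective u~π {i} {j} ui<uj =
  subst₂ _<_ (trans (sym (std-injective u u-injective i)) (u~π i))
             (trans (sym (std-injective u u-injective j)) (u~π j))
         (count-< (λ k → u k <? u i) (λ k → u k <? u j) (λ k uk<ui → <-trans uk<ui ui<uj)
                  ui<uj (<-irrefl refl))

word-< : ∀ {m} (π : Permutation′ m) i → word π i < m
word-< π i = Finₚ.toℕ<n (π ⟨$⟩ʳ i)

word-injective : ∀ {m} (π : Permutation′ m) → Injective _≡_ _≡_ (word π)
word-injective π eq =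
  trans (sym (inverseˡ π)) (trans (cong (π ⟨$⟩ˡ_) (Finₚ.toℕ-injective eq)) (inverseˡ π))

word-surjective : ∀ {m} (π : Permutation′ m) {v} → v < m → ∃ λ i → word π i ≡ v
word-surjective π v<m = π ⟨$⟩ˡ fromℕ< v<m , trans (cong toℕ (inverseʳ π)) (Finₚ.toℕ-fromℕ< v<m)

count-word< : ∀ {m} (π : Permutation′ m) {v} → v ≤ m → count (λ j → word π j <? v) ≡ v
count-word< π {v} v≤m =
  trans (count<-+ (word π) (word-injective π) 0 v (λ _ x<v → word-surjective π (<-≤-trans x<v v≤m)))
        (cong (_+ v) (count-none (λ j → word π j <? 0) (λ _ ())))

strictMono⇒injective : ∀ {h : ℕ → ℕ} → h Preserves _<_ ⟶ _<_ → Injective _≡_ _≡_ h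
strictMono⇒injective {h} h-mono {x} {y} hx≡hy with <-cmp x y
... | tri< x<y _ _ = ⊥-elim (<-irrefl hx≡hy (h-mono x<y))
... | tri≈ _ x≡y _ = x≡y
... | tri> _ _ y<x = ⊥-elim (<-irrefl (sym hx≡hy) (h-mono y<x))

strictMono⇒reflects-< : ∀ {h : ℕ → ℕ} → h Preserves _<_ ⟶ _<_ → ∀ {x y} → h x < h y → x < y
strictMono⇒reflects-< {h} h-mono {x} {y} hx<hy with <-cmp x y
... | tri< x<y _ _  = x<y
... | tri≈ _ refl _ = ⊥-elim (<-irrefl refl hx<hy)
... | tri> _ _ y<x  = ⊥-elim (<-asym hx<hy (h-mono y<x))

StdEq-strictMono : ∀ {m} (u : Word m) (π : Permutation′ m) {h : ℕ → ℕ} → h Preserves _<_ ⟶ _<_ →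
                   (∀ i → u i ≡ h (word π i)) → StdEq u π
StdEq-strictMono u π {h} h-mono u≡h∘π i = begin
  std u i
    ≡⟨ std-injective u u-injective i ⟩
  count (λ j → u j <? u i)
    ≡⟨ count-cong _ _ (λ j → strictMono⇒reflects-< h-mono ∘ subst₂ _<_ (u≡h∘π j) (u≡h∘π i))
                      (λ j → subst₂ _<_ (sym (u≡h∘π j)) (sym (u≡h∘π i)) ∘ h-mono) ⟩
  count (λ j → word π j <? word π i)
    ≡⟨ count-word< π (<⇒≤ (word-< π i)) ⟩
  word π i
    ∎
  where
  open ≡-Reasoning
  u-injective : Injective _≡_ _≡_ u
  u-injective {x} {y} ux≡uy =
    word-injective π (strictMono⇒injective h-mono (trans (sym (u≡h∘π x)) (trans ux≡uy (u≡h∘π y))))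

Image : ∀ {m} → Word m → ℕ → Set
Image u v = ∃ λ i → u i ≡ v

shift-covers : ∀ {m} {u : Word m} (π : Permutation′ m) {c} → (∀ i → u i ≡ c + word π i) →
               ∀ {y} → c ≤ y → y < c + m → Image u y
shift-covers {m} π {c} u≡c+π {y} c≤y y<c+m
  with word-surjective π (subst (y ∸ c <_) (m+n∸m≡n c m) (∸-monoˡ-< y<c+m c≤y))
... | i , πi≡y∸c = i , trans (u≡c+π i) (trans (cong (c +_) πi≡y∸c) (m+[n∸m]≡n c≤y))

shift-isInterval : ∀ {m} {u : Word m} (π : Permutation′ m) {c} → (∀ i → u i ≡ c + word π i) →
                   IsInterval (Image u)
shift-isInterval {m} π {c} u≡c+π x y z (i , ui≡x) (k , uk≡z) x≤y y≤z = shift-covers π u≡c+π c≤y y<c+m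
  where
  c≤y : c ≤ y
  c≤y = ≤-trans (subst (c ≤_) (trans (sym (u≡c+π i)) ui≡x) (m≤m+n c _)) x≤y
  y<c+m : y < c + m
  y<c+m = ≤-<-trans y≤z (subst (_< c + m) (trans (sym (u≡c+π k)) uk≡z) (+-monoʳ-< c (word-< π k)))

interval⇒shift : ∀ {m} (u : Word (suc m)) (π : Permutation′ (suc m)) → Injective _≡_ _≡_ u →
                 IsInterval (Image u) → StdEq u π → ∀ i → u i ≡ u (π ⟨$⟩ˡ Fin.zero) + word π i
interval⇒shift u π u-injective interval u~π i = begin
  u i             ≡⟨ sym (m+[n∸m]≡n (min≤ i)) ⟩
  c + (u i ∸ c)   ≡⟨ cong (c +_) (sym rank≡offset) ⟩
  c + word π i    ∎
  where
  open ≡-Reasoning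
  c : ℕ
  c = u (π ⟨$⟩ˡ Fin.zero)
  rank : ∀ j → count (λ k → u k <? u j) ≡ word π j
  rank j = trans (sym (std-injective u u-injective j)) (u~π j)
  nothing-below : count (λ k → u k <? c) ≡ 0
  nothing-below = trans (rank _) (cong toℕ (inverseʳ π))
  min≤ : ∀ j → c ≤ u j
  min≤ j = ≮⇒≥ (λ uj<c → <-irrefl (sym nothing-below) (count-witness (λ k → u k <? c) uj<c))
  covered : ∀ {x} → c ≤ x → x < c + (u i ∸ c) → Image u x
  covered c≤x x<ui = interval c _ (u i) (_ , refl) (i , refl) c≤x
                              (<⇒≤ (subst (_ <_) (m+[n∸m]≡n (min≤ i)) x<ui))
  rank≡offset : word π i ≡ u i ∸ c
  rank≡offset = begin
    word π i
      ≡⟨ rank i ⟨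
    count (λ k → u k <? u i)
      ≡⟨ cong (λ v → count (λ k → u k <? v)) (m+[n∸m]≡n (min≤ i)) ⟨
    count (λ k → u k <? c + (u i ∸ c))
      ≡⟨ count<-+ u u-injective c _ covered ⟩
    count (λ k → u k <? c) + (u i ∸ c)
      ≡⟨ cong (_+ (u i ∸ c)) nothing-below ⟩
    u i ∸ c
      ∎

injective⇒surjective : ∀ {n} (f : Fin n → Fin n) → Injective _≡_ _≡_ f → ∀ v → ∃ λ i → f i ≡ v
injective⇒surjective {suc n} f f-injective v with Finₚ.any? (λ i → f i Finₚ.≟ v)
... | yes hit = hit
... | no miss = ⊥-elim (1+n≰n (Finₚ.injective⇒≤ avoid-injective))
  where
  v≢f : ∀ i → v ≢ f i
  v≢f i v≡fi = miss (i , sym v≡fi)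
  avoid : Fin (suc n) → Fin n
  avoid i = punchOut (v≢f i)
  avoid-injective : Injective _≡_ _≡_ avoid
  avoid-injective {x} {y} = f-injective ∘ Finₚ.punchOut-injective (v≢f x) (v≢f y)

fromInjection : ∀ {n} (f : Fin n → Fin n) → Injective _≡_ _≡_ f → Permutation′ n
fromInjection f f-injective =
  permutation f (proj₁ ∘ surj) (proj₂ ∘ surj) (λ x → f-injective (proj₂ (surj (f x))))
  where
  surj : ∀ v → ∃ λ i → f i ≡ v
  surj = injective⇒surjective f f-injective

inject₁-or-fromℕ : ∀ {a} (p : Fin (suc a)) → (∃ λ i → p ≡ inject₁ i) ⊎ p ≡ fromℕ a
inject₁-or-fromℕ {zero}  Fin.zero    = inj₂ refl
inject₁-or-fromℕ {suc a} Fin.zero    = inj₁ (Fin.zero , refl)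
inject₁-or-fromℕ {suc a} (Fin.suc p) with inject₁-or-fromℕ p
... | inj₁ (i , refl) = inj₁ (Fin.suc i , refl)
... | inj₂ refl       = inj₂ refl

module _ (a b : ℕ) where

  toℕ-prefixPos : ∀ p → toℕ (prefixPos a b p) ≡ toℕ p
  toℕ-prefixPos p = trans (Finₚ.toℕ-cast _ (p ↑ˡ b)) (Finₚ.toℕ-↑ˡ p b)

  prefixPos-injective : Injective _≡_ _≡_ (prefixPos a b)
  prefixPos-injective {p} {p′} eq =
    Finₚ.toℕ-injective (trans (sym (toℕ-prefixPos p)) (trans (cong toℕ eq) (toℕ-prefixPos p′)))

  prefixPos-inject₁ : ∀ i → prefixPos a b (inject₁ i) ≡ i ↑ˡ suc b
  prefixPos-inject₁ i = Finₚ.toℕ-injective (begin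
    toℕ (prefixPos a b (inject₁ i))  ≡⟨ toℕ-prefixPos (inject₁ i) ⟩
    toℕ (inject₁ i)                  ≡⟨ Finₚ.toℕ-inject₁ i ⟩
    toℕ i                            ≡⟨ Finₚ.toℕ-↑ˡ i (suc b) ⟨
    toℕ (i ↑ˡ suc b)                 ∎)
    where open ≡-Reasoning

  prefixPos-last : prefixPos a b (fromℕ a) ≡ suffixPos a b Fin.zero
  prefixPos-last = Finₚ.toℕ-injective (begin
    toℕ (prefixPos a b (fromℕ a))  ≡⟨ toℕ-prefixPos (fromℕ a) ⟩
    toℕ (fromℕ a)                  ≡⟨ Finₚ.toℕ-fromℕ a ⟩
    a                              ≡⟨ +-identityʳ a ⟨
    a + 0                          ≡⟨ Finₚ.toℕ-↑ʳ a (Fin.zero {b}) ⟨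
    toℕ (suffixPos a b Fin.zero)   ∎)
    where open ≡-Reasoning

  prefixPos≢suffixPos : ∀ p j → prefixPos a b p ≢ suffixPos a b (Fin.suc j)
  prefixPos≢suffixPos p j eq = <⇒≱ (Finₚ.toℕ<n p) (begin
    suc a                           ≤⟨ m<m+n a (s≤s z≤n) ⟩
    a + suc (toℕ j)                 ≡⟨ Finₚ.toℕ-↑ʳ a (Fin.suc j) ⟨
    toℕ (suffixPos a b (Fin.suc j)) ≡⟨ cong toℕ eq ⟨
    toℕ (prefixPos a b p)           ≡⟨ toℕ-prefixPos p ⟩
    toℕ p                           ∎)
    where open ≤-Reasoning

  position-cases : ∀ q → (∃ λ p → q ≡ prefixPos a b p) ⊎ (∃ λ j → q ≡ suffixPos a b (Fin.suc j))
  position-cases q with splitAt a q in eq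
  ... | inj₁ i          = inj₁ (inject₁ i , sym (trans (prefixPos-inject₁ i) (Finₚ.splitAt⁻¹-↑ˡ eq)))
  ... | inj₂ Fin.zero    = inj₁ (fromℕ a , sym (trans prefixPos-last (Finₚ.splitAt⁻¹-↑ʳ eq)))
  ... | inj₂ (Fin.suc j) = inj₂ (j , sym (Finₚ.splitAt⁻¹-↑ʳ eq))

-- Values of τ keep their order but skip the block t, …, t + a taken by the prefix;
-- t itself is the letter shared with the prefix, which gets the value t + s.
module Gap (a t s : ℕ) where

  gap : ℕ → ℕ
  gap x with <-cmp x t
  ... | tri< _ _ _ = x
  ... | tri≈ _ _ _ = t + s
  ... | tri> _ _ _ = a + x

  gap-< : ∀ {x} → x < t → gap x ≡ x
  gap-< {x} x<t with <-cmp x t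
  ... | tri< _ _ _    = refl
  ... | tri≈ _ refl _ = ⊥-elim (<-irrefl refl x<t)
  ... | tri> _ _ t<x  = ⊥-elim (<-asym x<t t<x)

  gap-≡ : gap t ≡ t + s
  gap-≡ with <-cmp t t
  ... | tri< t<t _ _ = ⊥-elim (<-irrefl refl t<t)
  ... | tri≈ _ _ _   = refl
  ... | tri> _ _ t<t = ⊥-elim (<-irrefl refl t<t)

  gap-> : ∀ {x} → t < x → gap x ≡ a + x
  gap-> {x} t<x with <-cmp x t
  ... | tri< x<t _ _  = ⊥-elim (<-asym x<t t<x)
  ... | tri≈ _ refl _ = ⊥-elim (<-irrefl refl t<x)
  ... | tri> _ _ _    = refl

  gap-avoids : ∀ {x} → x ≢ t → gap x < t ⊎ t + a < gap x
  gap-avoids {x} x≢t with <-cmp x t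
  ... | tri< x<t _ _ = inj₁ x<t
  ... | tri≈ _ x≡t _ = ⊥-elim (x≢t x≡t)
  ... | tri> _ _ t<x = inj₂ (subst (_< a + x) (+-comm a t) (+-monoʳ-< a t<x))

  module _ (s≤a : s ≤ a) where

    gap-≤ : ∀ x → gap x ≤ a + x
    gap-≤ x with <-cmp x t
    ... | tri< _ _ _    = m≤n+m x a
    ... | tri≈ _ refl _ = subst (x + s ≤_) (+-comm x a) (+-monoʳ-≤ x s≤a)
    ... | tri> _ _ _    = ≤-refl

    gap-strictMono : gap Preserves _<_ ⟶ _<_
    gap-strictMono {x} {y} x<y with <-cmp x t | <-cmp y t
    ... | tri< _ _ _    | tri< _ _ _    = x<y
    ... | tri< x<t _ _  | tri≈ _ _ _    = <-≤-trans x<t (m≤m+n t s)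
    ... | tri< _ _ _    | tri> _ _ _    = <-≤-trans x<y (m≤n+m y a)
    ... | tri≈ _ refl _ | tri< y<t _ _  = ⊥-elim (<-asym x<y y<t)
    ... | tri≈ _ refl _ | tri≈ _ refl _ = ⊥-elim (<-irrefl refl x<y)
    ... | tri≈ _ refl _ | tri> _ _ _    = subst (_< a + y) gap-≡ (≤-<-trans (gap-≤ x) (+-monoʳ-< a x<y))
    ... | tri> _ _ t<x  | tri< y<t _ _  = ⊥-elim (<-asym x<y (<-trans y<t t<x))
    ... | tri> _ _ t<x  | tri≈ _ refl _ = ⊥-elim (<-asym x<y t<x)
    ... | tri> _ _ _    | tri> _ _ _    = +-monoʳ-< a x<y

module Canonical (a b : ℕ) (σ : Permutation′ (suc a)) (τ : Permutation′ (suc b)) where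

  t₀ : ℕ
  t₀ = word τ Fin.zero

  σ≤a : ∀ p → word σ p ≤ a
  σ≤a p = s≤s⁻¹ (word-< σ p)

  open Gap a t₀ (word σ (fromℕ a))

  IsCanonical : Permutation′ (a + suc b) → Set
  IsCanonical γ = (∀ p → word γ (prefixPos a b p) ≡ t₀ + word σ p)
                × (∀ j → word γ (suffixPos a b j) ≡ gap (word τ j))

  canonical⇒Good : ∀ γ → IsCanonical γ → Good a b σ τ γ
  canonical⇒Good γ (prefix , suffix) =
    (StdEq-strictMono _ σ (+-monoʳ-< t₀) prefix , StdEq-strictMono _ τ (gap-strictMono (σ≤a _)) suffix) ,
    shift-isInterval σ prefix

  canonical-unique : ∀ γ γ′ → IsCanonical γ → IsCanonical γ′ →
                     ∀ q → γ′ ⟨$⟩ʳ q ≡ γ ⟨$⟩ʳ q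
  canonical-unique γ γ′ (prefix , suffix) (prefix′ , suffix′) q =
    Finₚ.toℕ-injective (agree (position-cases a b q))
    where
    agree : (∃ λ p → q ≡ prefixPos a b p) ⊎ (∃ λ j → q ≡ suffixPos a b (Fin.suc j)) →
            word γ′ q ≡ word γ q
    agree (inj₁ (p , refl)) = trans (prefix′ p) (sym (prefix p))
    agree (inj₂ (j , refl)) = trans (suffix′ _) (sym (suffix _))

  τ-suc≢t₀ : ∀ j → word τ (Fin.suc j) ≢ t₀
  τ-suc≢t₀ j eq with word-injective τ eq
  ... | ()

  prefix≢suffix : ∀ p j → t₀ + word σ p ≢ gap (word τ (Fin.suc j))
  prefix≢suffix p j eq with gap-avoids (τ-suc≢t₀ j)
  ... | inj₁ gap<t₀   = <⇒≱ gap<t₀ (subst (t₀ ≤_) eq (m≤m+n t₀ _))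
  ... | inj₂ t₀+a<gap = <⇒≱ t₀+a<gap (subst (_≤ t₀ + a) eq (+-monoʳ-≤ t₀ (σ≤a p)))

  values : Word (a + suc b)
  values q = [ (λ i → t₀ + word σ (inject₁ i)) , gap ∘ word τ ]′ (splitAt a q)

  values-suffix : ∀ j → values (suffixPos a b j) ≡ gap (word τ j)
  values-suffix j rewrite Finₚ.splitAt-↑ʳ a (suc b) j = refl

  values-prefix : ∀ p → values (prefixPos a b p) ≡ t₀ + word σ p
  values-prefix p with inject₁-or-fromℕ p
  ... | inj₁ (i , refl) rewrite prefixPos-inject₁ a b i | Finₚ.splitAt-↑ˡ a i (suc b) = refl
  ... | inj₂ refl = trans (cong values (prefixPos-last a b)) (trans (values-suffix Fin.zero) gap-≡)

  values-< : ∀ q → values q < a + suc b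
  values-< q with position-cases a b q
  ... | inj₁ (p , refl) rewrite values-prefix p = begin-strict
    t₀ + word σ p  ≤⟨ +-mono-≤ (s≤s⁻¹ (word-< τ Fin.zero)) (σ≤a p) ⟩
    b + a          ≡⟨ +-comm b a ⟩
    a + b          <⟨ +-monoʳ-< a (n<1+n b) ⟩
    a + suc b      ∎
    where open ≤-Reasoning
  ... | inj₂ (j , refl) rewrite values-suffix (Fin.suc j) =
    ≤-<-trans (gap-≤ (σ≤a _) _) (+-monoʳ-< a (word-< τ (Fin.suc j)))

  values-injective : Injective _≡_ _≡_ values
  values-injective {x} {y} eq with position-cases a b x | position-cases a b y
  ... | inj₁ (p , refl) | inj₁ (p′ , refl) = cong (prefixPos a b) (word-injective σ
    (+-cancelˡ-≡ t₀ _ _ (trans (sym (values-prefix p)) (trans eq (values-prefix p′)))))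
  ... | inj₂ (j , refl) | inj₂ (j′ , refl) = cong (suffixPos a b) (word-injective τ
    (strictMono⇒injective (gap-strictMono (σ≤a _)) (trans (sym (values-suffix _)) (trans eq (values-suffix _)))))
  ... | inj₁ (p , refl) | inj₂ (j , refl) =
    ⊥-elim (prefix≢suffix p j (trans (sym (values-prefix p)) (trans eq (values-suffix _))))
  ... | inj₂ (j , refl) | inj₁ (p , refl) =
    ⊥-elim (prefix≢suffix p j (trans (sym (values-prefix p)) (trans (sym eq) (values-suffix _))))

  canonical : Permutation′ (a + suc b)
  canonical = fromInjection (λ q → fromℕ< (values-< q))
                            (values-injective ∘ Finₚ.fromℕ<-injective _ _ (values-< _) (values-< _))

  canonical-isCanonical : IsCanonical canonical
  canonical-isCanonical = (λ p → trans (Finₚ.toℕ-fromℕ< _) (values-prefix p)) ,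
                          (λ j → trans (Finₚ.toℕ-fromℕ< _) (values-suffix j))

  module FromGood (γ : Permutation′ (a + suc b)) (good : Good a b σ τ γ) where

    open ≡-Reasoning

    w : Word (a + suc b)
    w = word γ

    f : Word (suc a)
    f p = w (prefixPos a b p)

    g : Word (suc b)
    g j = w (suffixPos a b j)

    g-std : StdEq g τ
    g-std = proj₂ (proj₁ good)

    f-injective : Injective _≡_ _≡_ f
    f-injective = prefixPos-injective a b ∘ word-injective γ

    g-injective : Injective _≡_ _≡_ g
    g-injective {j} {j′} = Finₚ.↑ʳ-injective a j j′ ∘ word-injective γ

    c : ℕ
    c = f (σ ⟨$⟩ˡ Fin.zero)

    f≡c+σ : ∀ p → f p ≡ c + word σ p
    f≡c+σ = interval⇒shift f σ f-injective (proj₂ good) (proj₁ (proj₁ good))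

    g₀≡ : g Fin.zero ≡ c + word σ (fromℕ a)
    g₀≡ = trans (cong w (sym (prefixPos-last a b))) (f≡c+σ (fromℕ a))

    c≤g₀ : c ≤ g Fin.zero
    c≤g₀ = subst (c ≤_) (sym g₀≡) (m≤m+n c _)

    g₀≤c+a : g Fin.zero ≤ c + a
    g₀≤c+a = subst (_≤ c + a) (sym g₀≡) (+-monoʳ-≤ c (σ≤a _))

    g-avoids : ∀ j → g (Fin.suc j) < c ⊎ c + a < g (Fin.suc j)
    g-avoids j with g (Fin.suc j) <? c | c + a <? g (Fin.suc j)
    ... | yes below | _         = inj₁ below
    ... | no _      | yes above = inj₂ above
    ... | no ¬below | no ¬above
      with shift-covers σ f≡c+σ (≮⇒≥ ¬below)
                        (subst (g (Fin.suc j) <_) (sym (+-suc c a)) (s≤s (≮⇒≥ ¬above)))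
    ... | p , fp≡g = ⊥-elim (prefixPos≢suffixPos a b p j (word-injective γ fp≡g))

    inner : Word a
    inner i = w (i ↑ˡ suc b)

    inner≡ : ∀ i → inner i ≡ c + word σ (inject₁ i)
    inner≡ i = trans (cong w (sym (prefixPos-inject₁ a b i))) (f≡c+σ (inject₁ i))

    inner-below : ∀ {v} → v ≤ c → count (λ i → inner i <? v) ≡ 0
    inner-below v≤c = count-none _ λ i inner<v →
      <⇒≱ (<-≤-trans inner<v v≤c) (subst (c ≤_) (sym (inner≡ i)) (m≤m+n c _))

    inner-above : ∀ {v} → c + a < v → count (λ i → inner i <? v) ≡ a
    inner-above c+a<v = count-all _ λ i →
      subst (_< _) (sym (inner≡ i)) (≤-<-trans (+-monoʳ-≤ c (σ≤a _)) c+a<v)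

    count-split : ∀ v → v ≤ a + suc b → v ≡ count (λ i → inner i <? v) + count (λ k → g k <? v)
    count-split v v≤n = trans (sym (count-word< γ v≤n)) (count-↑ a (λ q → w q <? v))

    g≡ : ∀ j → g j ≡ count (λ i → inner i <? g j) + word τ j
    g≡ j = trans (count-split (g j) (<⇒≤ (word-< γ _)))
                 (cong (count (λ i → inner i <? g j) +_) (trans (sym (std-injective g g-injective j)) (g-std j)))

    c≡t₀ : c ≡ t₀
    c≡t₀ = begin
      c
        ≡⟨ count-split c (<⇒≤ (word-< γ _)) ⟩
      count (λ i → inner i <? c) + count (λ k → g k <? c)
        ≡⟨ cong₂ _+_ (inner-below ≤-refl)
                     (count-cong (λ k → g k <? c) (λ k → g k <? g Fin.zero)
                                 below-c⇒below-g₀ below-g₀⇒below-c) ⟩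
      count (λ k → g k <? g Fin.zero)
        ≡⟨ std-injective g g-injective Fin.zero ⟨
      std g Fin.zero
        ≡⟨ g-std Fin.zero ⟩
      t₀
        ∎
      where
      below-c⇒below-g₀ : ∀ k → g k < c → g k < g Fin.zero
      below-c⇒below-g₀ k gk<c = <-≤-trans gk<c c≤g₀
      below-g₀⇒below-c : ∀ k → g k < g Fin.zero → g k < c
      below-g₀⇒below-c Fin.zero    g₀<g₀ = ⊥-elim (<-irrefl refl g₀<g₀)
      below-g₀⇒below-c (Fin.suc j) gj<g₀ with g-avoids j
      ... | inj₁ below = below
      ... | inj₂ above = ⊥-elim (<-asym gj<g₀ (≤-<-trans g₀≤c+a above))

    g-suc : ∀ j → g (Fin.suc j) ≡ gap (word τ (Fin.suc j))
    g-suc j with g-avoids j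
    ... | inj₁ below = begin
      g (Fin.suc j)
        ≡⟨ g≡ (Fin.suc j) ⟩
      count (λ i → inner i <? g (Fin.suc j)) + word τ (Fin.suc j)
        ≡⟨ cong (_+ word τ (Fin.suc j)) (inner-below (<⇒≤ below)) ⟩
      word τ (Fin.suc j)
        ≡⟨ gap-< (std-injective-< g τ g-injective g-std (<-≤-trans below c≤g₀)) ⟨
      gap (word τ (Fin.suc j))
        ∎
    ... | inj₂ above = begin
      g (Fin.suc j)
        ≡⟨ g≡ (Fin.suc j) ⟩
      count (λ i → inner i <? g (Fin.suc j)) + word τ (Fin.suc j)
        ≡⟨ cong (_+ word τ (Fin.suc j)) (inner-above above) ⟩
      a + word τ (Fin.suc j)
        ≡⟨ gap-> (std-injective-< g τ g-injective g-std (≤-<-trans g₀≤c+a above)) ⟨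
      gap (word τ (Fin.suc j))
        ∎

    isCanonical : IsCanonical γ
    isCanonical = (λ p → trans (f≡c+σ p) (cong (_+ word σ p) c≡t₀)) , g≡gap∘τ
      where
      g≡gap∘τ : ∀ j → g j ≡ gap (word τ j)
      g≡gap∘τ Fin.zero    = trans g₀≡ (trans (cong (_+ word σ (fromℕ a)) c≡t₀) (sym gap-≡))
      g≡gap∘τ (Fin.suc j) = g-suc j

  Good⇒canonical : ∀ γ → Good a b σ τ γ → IsCanonical γ
  Good⇒canonical = FromGood.isCanonical

lemma4p6 : (a b : ℕ) (σ : Permutation′ (suc a)) (τ : Permutation′ (suc b))
         → Σ (Permutation′ (a + suc b)) (λ γ → Good a b σ τ γ
             × ((γ′ : Permutation′ (a + suc b)) → Good a b σ τ γ′
                → ∀ i → γ′ ⟨$⟩ʳ i ≡ γ ⟨$⟩ʳ i))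
lemma4p6 a b σ τ =
  canonical , canonical⇒Good canonical canonical-isCanonical ,
  λ γ′ good → canonical-unique canonical γ′ canonical-isCanonical (Good⇒canonical γ′ good)
  where open Canonical a b σ τ
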